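{- Let $G$ be a connected finite simple graph with $|V(G)|\ge 3$ and $\det(G)=1$. Then $\det'(G)=2$ if $G$ is edge-flip-invariant, and $\det'(G)=1$ otherwise.
   Context: $G$ is edge-flip-invariant if for every edge $\{u,v\}$ there is an automorphism $\phi$ with $\phi(u)=v$ and $\phi(v)=u$. A vertex set $S$ is a vertex determining set if the only automorphism fixing every vertex of $S$ is the identity; $\det(G)$ is the minimum size of such a set. For a graph with at most one isolated vertex and no $K_2$ component, an edge set $T$ is an edge determining set if the only automorphism $\phi$ with $\{\phi(u),\phi(v)\}=\{u,v\}$ for all $\{u,v\}\in T$ is the identity; $\det'(G)$ is the minimum size of such a set. -}

module Defs where

open import Data.Nat using (ℕ; _≤_)
open import Data.Bool using (Bool; true; false)
open import Data.Fin using (Fin)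
open import Data.Fin.Subset using (Subset; _∈_; ∣_∣)
open import Data.Fin.Permutation using (Permutation′; _⟨$⟩ʳ_)
open import Data.List using (List; length)
open import Data.List.Membership.Propositional renaming (_∈_ to _∈ₗ_)
open import Data.Product using (Σ; ∃; _×_; _,_)
open import Data.Sum using (_⊎_)
open import Relation.Binary.PropositionalEquality using (_≡_)

record Graph (n : ℕ) : Set where
  field
    adj     : Fin n → Fin n → Bool
    sym     : ∀ u v → adj u v ≡ adj v u
    irrefl  : ∀ u → adj u u ≡ false

open Graph public

Edge : ∀ {n} → Graph n → Fin n → Fin n → Set
Edge G u v = adj G u v ≡ true

data Reach {n} (G : Graph n) : Fin n → Fin n → Set where
  here : ∀ {u} → Reach G u u
  step : ∀ {u v w} → Edge G u v → Reach G v w → Reach G u w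

Connected : ∀ {n} → Graph n → Set
Connected G = ∀ u v → Reach G u v

IsAut : ∀ {n} → Graph n → Permutation′ n → Set
IsAut G φ = ∀ u v → adj G (φ ⟨$⟩ʳ u) (φ ⟨$⟩ʳ v) ≡ adj G u v

IsIdentity : ∀ {n} → Permutation′ n → Set
IsIdentity φ = ∀ x → φ ⟨$⟩ʳ x ≡ x

EdgeFlipInvariant : ∀ {n} → Graph n → Set
EdgeFlipInvariant {n} G =
  ∀ u v → Edge G u v →
  Σ (Permutation′ n) λ φ → IsAut G φ × (φ ⟨$⟩ʳ u ≡ v) × (φ ⟨$⟩ʳ v ≡ u)

VertexDetermining : ∀ {n} → Graph n → Subset n → Set
VertexDetermining {n} G S =
  (φ : Permutation′ n) → IsAut G φ → (∀ x → x ∈ S → φ ⟨$⟩ʳ x ≡ x) → IsIdentity φ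

DetIs : ∀ {n} → Graph n → ℕ → Set
DetIs {n} G k =
  (Σ (Subset n) λ S → VertexDetermining G S × ∣ S ∣ ≡ k)
  × (∀ S → VertexDetermining G S → k ≤ ∣ S ∣)

-- Edge sets are represented as lists of (ordered) vertex pairs, each an edge.
-- (Duplicates only increase length, so the minimum length equals the minimum
-- size of an edge set.)
EdgeList : ∀ {n} → Graph n → List (Fin n × Fin n) → Set
EdgeList G T = ∀ {u v} → (u , v) ∈ₗ T → Edge G u v

FixesSetwise : ∀ {n} → Permutation′ n → Fin n → Fin n → Set
FixesSetwise φ u v =
  ((φ ⟨$⟩ʳ u ≡ u) × (φ ⟨$⟩ʳ v ≡ v)) ⊎ ((φ ⟨$⟩ʳ u ≡ v) × (φ ⟨$⟩ʳ v ≡ u))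

EdgeDetermining : ∀ {n} → Graph n → List (Fin n × Fin n) → Set
EdgeDetermining {n} G T =
  (φ : Permutation′ n) → IsAut G φ →
  (∀ {u v} → (u , v) ∈ₗ T → FixesSetwise φ u v) → IsIdentity φ

EdgeDetIs : ∀ {n} → Graph n → ℕ → Set
EdgeDetIs {n} G k =
  (Σ (List (Fin n × Fin n)) λ T → EdgeList G T × EdgeDetermining G T × length T ≡ k)
  × (∀ T → EdgeList G T → EdgeDetermining G T → k ≤ length T)

-- A vertex x forming a determining set of size one is rigid: only the identity
-- fixes it. Rigidity is preserved by automorphisms, so it spreads from x along
-- every edge that can be flipped. Hence if G is not edge-flip-invariant, a walk
-- from x reaches an unflippable edge {a,b} with a rigid, and {a,b} alone is
-- determining: an automorphism fixing it setwise cannot swap a and b, so it fixes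
-- a. If G is edge-flip-invariant, no single edge is determining (its flip is a
-- nontrivial automorphism), but an edge {x,y} together with an edge {c,d} leaving
-- {x,y} at c is: an automorphism swapping x and y would move c outside {c,d}.
-- In both cases the empty set is not determining, as det(G) = 1.
module Submission where

open import Defs hiding (sym)
open import Data.Bool using (true; false; _≟_)
open import Data.Fin using (Fin; zero; suc)
open import Data.Fin.Permutation
  using (Permutation′; _⟨$⟩ʳ_; _⟨$⟩ˡ_; _≈_; permutation; flip; _∘ₚ_; inverseˡ; inverseʳ)
open import Data.Fin.Properties using (any?; all?) renaming (_≟_ to _≟ᶠ_)
open import Data.Fin.Subset using (Subset; ⊥; ∣_∣) renaming (_∈_ to _∈ˢ_)
open import Data.Fin.Subset.Properties using (∣⊥∣≡0)
open import Data.List using ([]; _∷_; [_]; length)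
open import Data.List.Relation.Unary.Any using (here; there)
open import Data.Nat using (ℕ; zero; suc; _+_; _≥_; _≤_; s≤s; z≤n; pred)
open import Data.Product using (_×_; Σ; ∃; ∃₂; _,_; proj₁; proj₂)
open import Data.Sum using (_⊎_; inj₁; inj₂)
open import Data.Vec using (_∷_)
open import Data.Vec.Functional using (head; tail) renaming (_∷_ to _∷ᶠ_)
open import Data.Vec.Functional.Properties using (∷-cong)
import Data.Vec.Base as Vec
open import Relation.Binary.PropositionalEquality
  using (_≡_; _≢_; _≗_; refl; sym; trans; cong; cong₂; subst; module ≡-Reasoning)
open import Relation.Nullary using (¬_; Dec; yes; no; contradiction)
open import Relation.Nullary.Decidable using (_×-dec_; _⊎-dec_; ¬?; decidable-stable)
open import Relation.Unary using (Pred; Decidable)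

anyFunction? : ∀ k {m p} {P : Pred (Fin k → Fin m) p} →
  (∀ {f g} → f ≗ g → P f → P g) → Decidable P → Dec (∃ P)
anyFunction? zero resp P? with P? (λ ())
... | yes p = yes (_ , p)
... | no ¬p = no λ (f , pf) → ¬p (resp (λ ()) pf)
anyFunction? (suc k) {P = P} resp P?
  with any? (λ a → anyFunction? k {P = λ g → P (a ∷ᶠ g)}
                     (λ f≗g → resp (∷-cong refl f≗g)) (λ g → P? (a ∷ᶠ g)))
... | yes (a , g , p) = yes (a ∷ᶠ g , p)
... | no ¬p = no λ (f , pf) → ¬p (head f , tail f , resp (∷-cong refl (λ _ → refl)) pf)

module _ {n p} {P : Pred (Permutation′ n) p} (resp : ∀ {φ ψ} → φ ≈ ψ → P φ → P ψ) (P? : Decidable P) where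

  private
    AreInverse : (Fin n → Fin n) → (Fin n → Fin n) → Set
    AreInverse f g = (∀ i → f (g i) ≡ i) × (∀ i → g (f i) ≡ i)

    areInverse? : ∀ f g → Dec (AreInverse f g)
    areInverse? f g = all? (λ i → f (g i) ≟ᶠ i) ×-dec all? (λ i → g (f i) ≟ᶠ i)

    Witness : (Fin n → Fin n) → (Fin n → Fin n) → Set p
    Witness f g = Σ (AreInverse f g) λ (fg , gf) → P (permutation f g fg gf)

    witness? : ∀ f g → Dec (Witness f g)
    witness? f g with areInverse? f g
    ... | no ¬inv = no λ (inv , _) → ¬inv inv
    ... | yes (fg , gf) with P? (permutation f g fg gf)
    ...   | yes p = yes ((fg , gf) , p)
    ...   | no ¬p = no λ (_ , p) → ¬p (resp (λ _ → refl) p)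

    witness-respʳ : ∀ f {g g′} → g ≗ g′ → Witness f g → Witness f g′
    witness-respʳ f g≗g′ ((fg , gf) , p) =
      ( (λ i → subst (λ j → f j ≡ i) (g≗g′ i) (fg i))
      , (λ i → trans (sym (g≗g′ (f i))) (gf i)) )
      , resp (λ _ → refl) p

    witness-respˡ : ∀ {f f′} → f ≗ f′ → ∃ (Witness f) → ∃ (Witness f′)
    witness-respˡ {f} {f′} f≗f′ (g , (fg , gf) , p) =
      g , ( (λ i → trans (sym (f≗f′ (g i))) (fg i))
          , (λ i → subst (λ j → g j ≡ i) (f≗f′ i) (gf i)) )
        , resp f≗f′ p

  anyPermutation? : Dec (∃ P)
  anyPermutation? with anyFunction? n witness-respˡ (λ f → anyFunction? n (witness-respʳ f) (witness? f))
  ... | yes (f , g , (fg , gf) , p) = yes (permutation f g fg gf , p)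
  ... | no ¬p = no λ (φ , p) →
    ¬p ((φ ⟨$⟩ʳ_) , (φ ⟨$⟩ˡ_) , ((λ _ → inverseʳ φ) , (λ _ → inverseˡ φ)) , resp (λ _ → refl) p)

∣p∣≡0⇒x∉p : ∀ {n} {p : Subset n} {x} → ∣ p ∣ ≡ 0 → ¬ x ∈ˢ p
∣p∣≡0⇒x∉p {p = false ∷ p} ∣p∣≡0 (Vec.there x∈p) = ∣p∣≡0⇒x∉p ∣p∣≡0 x∈p

∣p∣≡1⇒singleton : ∀ {n} (p : Subset n) → ∣ p ∣ ≡ 1 → ∃ λ x → ∀ {y} → y ∈ˢ p → y ≡ x
∣p∣≡1⇒singleton (true ∷ p) ∣p∣≡1 = zero , λ
  { Vec.here → refl
  ; (Vec.there y∈p) → contradiction y∈p (∣p∣≡0⇒x∉p (cong pred ∣p∣≡1)) }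
∣p∣≡1⇒singleton (false ∷ p) ∣p∣≡1 with ∣p∣≡1⇒singleton p ∣p∣≡1
... | x , p⊆x = suc x , λ { (Vec.there y∈p) → cong suc (p⊆x y∈p) }

module _ {n : ℕ} (G : Graph n) where

  edge⇒≢ : ∀ {u v} → Edge G u v → u ≢ v
  edge⇒≢ {u} e refl with trans (sym e) (irrefl G u)
  ... | ()

  reach-exits : ∀ {p} {P : Pred (Fin n) p} → Decidable P → ∀ {u w} → Reach G u w → P u → ¬ P w →
    ∃₂ λ c d → Edge G c d × P c × ¬ P d
  reach-exits P? here Pu ¬Pw = contradiction Pu ¬Pw
  reach-exits P? (step {v = v} e r) Pu ¬Pw with P? v
  ... | yes Pv = reach-exits P? r Pv ¬Pw
  ... | no ¬Pv = _ , v , e , Pu , ¬Pv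

  IsAut-≈ : ∀ {φ ψ} → φ ≈ ψ → IsAut G φ → IsAut G ψ
  IsAut-≈ φ≈ψ aut u v = trans (sym (cong₂ (adj G) (φ≈ψ u) (φ≈ψ v))) (aut u v)

  IsAut? : Decidable (IsAut G)
  IsAut? φ = all? λ u → all? λ v → adj G (φ ⟨$⟩ʳ u) (φ ⟨$⟩ʳ v) ≟ adj G u v

  IsAut-∘ : ∀ {φ ψ} → IsAut G φ → IsAut G ψ → IsAut G (φ ∘ₚ ψ)
  IsAut-∘ autφ autψ u v = trans (autψ _ _) (autφ u v)

  IsAut-flip : ∀ {φ} → IsAut G φ → IsAut G (flip φ)
  IsAut-flip {φ} aut u v =
    trans (sym (aut _ _)) (cong₂ (adj G) (inverseʳ φ) (inverseʳ φ))

  Flippable : Fin n → Fin n → Set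
  Flippable u v = Σ (Permutation′ n) λ φ → IsAut G φ × (φ ⟨$⟩ʳ u ≡ v) × (φ ⟨$⟩ʳ v ≡ u)

  -- Decidability is what lets ¬ EdgeFlipInvariant G yield an actual unflippable edge.
  flippable? : ∀ u v → Dec (Flippable u v)
  flippable? u v = anyPermutation?
    (λ {φ} {ψ} φ≈ψ (aut , φu , φv) →
       IsAut-≈ {φ} {ψ} φ≈ψ aut , trans (sym (φ≈ψ u)) φu , trans (sym (φ≈ψ v)) φv)
    (λ φ → IsAut? φ ×-dec (φ ⟨$⟩ʳ u ≟ᶠ v) ×-dec (φ ⟨$⟩ʳ v ≟ᶠ u))

  Rigid : Fin n → Set
  Rigid x = ∀ φ → IsAut G φ → φ ⟨$⟩ʳ x ≡ x → IsIdentity φ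

  rigid-image : ∀ {x} φ → IsAut G φ → Rigid x → Rigid (φ ⟨$⟩ʳ x)
  rigid-image {x} φ autφ rigid ψ autψ ψφx≡φx y = begin
    ψ ⟨$⟩ʳ y                      ≡⟨ cong (ψ ⟨$⟩ʳ_) (inverseʳ φ) ⟨
    ψ ⟨$⟩ʳ (φ ⟨$⟩ʳ (φ ⟨$⟩ˡ y))    ≡⟨ inverseʳ φ ⟨
    φ ⟨$⟩ʳ (χ ⟨$⟩ʳ (φ ⟨$⟩ˡ y))    ≡⟨ cong (φ ⟨$⟩ʳ_) (χ-id (φ ⟨$⟩ˡ y)) ⟩
    φ ⟨$⟩ʳ (φ ⟨$⟩ˡ y)             ≡⟨ inverseʳ φ ⟩
    y                             ∎
    where
    open ≡-Reasoning
    χ : Permutation′ n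
    χ = φ ∘ₚ ψ ∘ₚ flip φ
    χ-id : IsIdentity χ
    χ-id = rigid χ
      (IsAut-∘ {φ} {ψ ∘ₚ flip φ} autφ (IsAut-∘ {ψ} {flip φ} autψ (IsAut-flip {φ} autφ)))
      (trans (cong (φ ⟨$⟩ˡ_) ψφx≡φx) (inverseˡ φ))

  DetIs1⇒rigid : DetIs G 1 → ∃ Rigid
  DetIs1⇒rigid ((S , determining , ∣S∣≡1) , _) with ∣p∣≡1⇒singleton S ∣S∣≡1
  ... | x , S⊆x = x , λ φ aut φx≡x →
    determining φ aut λ y y∈S → subst (λ z → φ ⟨$⟩ʳ z ≡ z) (sym (S⊆x y∈S)) φx≡x

  DetIs1⇒¬EdgeDetermining[] : DetIs G 1 → ¬ EdgeDetermining G []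
  DetIs1⇒¬EdgeDetermining[] (_ , minimal) determining
    with subst (1 ≤_) (∣⊥∣≡0 n) (minimal ⊥ λ φ aut _ → determining φ aut λ ())
  ... | ()

  DetIs1⇒EdgeDetermining⇒1≤length : DetIs G 1 → ∀ T → EdgeDetermining G T → 1 ≤ length T
  DetIs1⇒EdgeDetermining⇒1≤length det1 []      determining =
    contradiction determining (DetIs1⇒¬EdgeDetermining[] det1)
  DetIs1⇒EdgeDetermining⇒1≤length det1 (_ ∷ _) _ = s≤s z≤n

  flippable⇒¬singletonEdgeDetermining : ∀ {u v} → Edge G u v → Flippable u v → ¬ EdgeDetermining G [ (u , v) ]
  flippable⇒¬singletonEdgeDetermining {u} e (φ , aut , φu≡v , φv≡u) determining =
    edge⇒≢ e (trans (sym (determining φ aut (λ { (here refl) → inj₂ (φu≡v , φv≡u) }) u)) φu≡v)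

  rigid-unflippable⇒singletonEdgeDetermining : ∀ {a b} → Rigid a → ¬ Flippable a b → EdgeDetermining G [ (a , b) ]
  rigid-unflippable⇒singletonEdgeDetermining rigid unflippable φ aut fixes with fixes (here refl)
  ... | inj₁ (φa≡a , _) = rigid φ aut φa≡a
  ... | inj₂ swap = contradiction (φ , aut , swap) unflippable

  rigid-reach-unflippable : ∀ {a c d} → Rigid a → Reach G a c → Edge G c d → ¬ Flippable c d →
    ∃₂ λ p q → Edge G p q × Rigid p × ¬ Flippable p q
  rigid-reach-unflippable rigid here e unflippable = _ , _ , e , rigid , unflippable
  rigid-reach-unflippable rigid (step {u} {v} e r) e′ unflippable′ with flippable? u v
  ... | yes (φ , aut , φu≡v , _) =
    rigid-reach-unflippable (subst Rigid φu≡v (rigid-image φ aut rigid)) r e′ unflippable′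
  ... | no unflippable = _ , _ , e , rigid , unflippable

  rigid-edgePair⇒EdgeDetermining : ∀ {x y c d} → Rigid x → x ≢ y → c ≡ x ⊎ c ≡ y → d ≢ x → d ≢ y →
    EdgeDetermining G ((x , y) ∷ [ (c , d) ])
  rigid-edgePair⇒EdgeDetermining rigid x≢y c∈xy d≢x d≢y φ aut fixes
    with fixes (here refl) | fixes (there (here refl)) | c∈xy
  ... | inj₁ (φx≡x , _) | _               | _         = rigid φ aut φx≡x
  ... | inj₂ (φx≡y , _) | inj₁ (φx≡x , _) | inj₁ refl = contradiction (trans (sym φx≡x) φx≡y) x≢y
  ... | inj₂ (φx≡y , _) | inj₂ (φx≡d , _) | inj₁ refl = contradiction (trans (sym φx≡d) φx≡y) d≢y
  ... | inj₂ (_ , φy≡x) | inj₁ (φy≡y , _) | inj₂ refl = contradiction (trans (sym φy≡x) φy≡y) x≢y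
  ... | inj₂ (_ , φy≡x) | inj₂ (φy≡d , _) | inj₂ refl = contradiction (trans (sym φy≡d) φy≡x) d≢x

  module _ (connected : Connected G) (det1 : DetIs G 1) where

    private
      x = proj₁ (DetIs1⇒rigid det1)
      x-rigid = proj₂ (DetIs1⇒rigid det1)

    ¬EdgeFlipInvariant⇒EdgeDetIs1 : ¬ EdgeFlipInvariant G → EdgeDetIs G 1
    ¬EdgeFlipInvariant⇒EdgeDetIs1 ¬efi
      with any? (λ c → any? λ d → (adj G c d ≟ true) ×-dec ¬? (flippable? c d))
    ... | no noUnflippable = contradiction
      (λ c d e → decidable-stable (flippable? c d) λ ¬f → noUnflippable (c , d , e , ¬f))
      ¬efi
    ... | yes (c , d , e , unflippable)
      with rigid-reach-unflippable x-rigid (connected x c) e unflippable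
    ...   | a , b , e′ , a-rigid , a-unflippable =
      ( [ (a , b) ]
      , (λ { (here refl) → e′ })
      , rigid-unflippable⇒singletonEdgeDetermining a-rigid a-unflippable
      , refl )
      , λ T _ → DetIs1⇒EdgeDetermining⇒1≤length det1 T

    EdgeFlipInvariant⇒EdgeDetIs2 : (∀ a b → ∃ λ w → w ≢ a × w ≢ b) → EdgeFlipInvariant G → EdgeDetIs G 2
    EdgeFlipInvariant⇒EdgeDetIs2 avoid efi with avoid x x
    ... | w , w≢x , _
      with reach-exits (_≟ᶠ x) (connected x w) refl w≢x
    ... | _ , y , exy , refl , _
      with avoid x y
    ... | w′ , w′≢x , w′≢y
      with reach-exits (λ c → (c ≟ᶠ x) ⊎-dec (c ≟ᶠ y)) (connected x w′) (inj₁ refl)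
                       (λ { (inj₁ e) → w′≢x e ; (inj₂ e) → w′≢y e })
    ... | c , d , ecd , c∈xy , d∉xy =
      ( (x , y) ∷ [ (c , d) ]
      , (λ { (here refl) → exy ; (there (here refl)) → ecd })
      , rigid-edgePair⇒EdgeDetermining x-rigid (edge⇒≢ exy) c∈xy
          (λ e → d∉xy (inj₁ e)) (λ e → d∉xy (inj₂ e))
      , refl )
      , lower
      where
      lower : ∀ T → EdgeList G T → EdgeDetermining G T → 2 ≤ length T
      lower []             _     determining = contradiction determining (DetIs1⇒¬EdgeDetermining[] det1)
      lower ((u , v) ∷ []) edges determining =
        contradiction determining
          (flippable⇒¬singletonEdgeDetermining (edges (here refl)) (efi u v (edges (here refl))))
      lower (_ ∷ _ ∷ _)    _     _           = s≤s (s≤s z≤n)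

avoid₂ : ∀ {m} (a b : Fin (3 + m)) → ∃ λ w → w ≢ a × w ≢ b
avoid₂ a b with a ≟ᶠ suc (suc zero) | b ≟ᶠ suc (suc zero)
... | no a≢2 | no b≢2 = _ , (λ e → a≢2 (sym e)) , (λ e → b≢2 (sym e))
... | yes refl | _ with b ≟ᶠ zero
...   | yes refl = suc zero , (λ ()) , (λ ())
...   | no b≢0 = zero , (λ ()) , (λ e → b≢0 (sym e))
avoid₂ a b | no _ | yes refl with a ≟ᶠ zero
...   | yes refl = suc zero , (λ ()) , (λ ())
...   | no a≢0 = zero , (λ e → a≢0 (sym e)) , (λ ())

corollary2 : (n : ℕ) (G : Graph n) → n ≥ 3 → Connected G → DetIs G 1 →
    (EdgeFlipInvariant G → EdgeDetIs G 2) × (¬ EdgeFlipInvariant G → EdgeDetIs G 1)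
corollary2 (suc (suc (suc m))) G (s≤s (s≤s (s≤s _))) connected det1 =
    EdgeFlipInvariant⇒EdgeDetIs2 G connected det1 avoid₂
  , ¬EdgeFlipInvariant⇒EdgeDetIs1 G connected det1
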